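{- Let $x>0$ be real and $G\in\mathrm{Tame}_x$. (a) Suppose $A$ is a Left option of $G$ that has a Right option $A^R$ with $A^R\leq_xG$, and let $W,X,Y,\dots$ be the Left options of $A^R$. Let $G'$ be the game obtained from $G$ by replacing the Left option $A$ by the options $W,X,Y,\dots$ (all other options and the score unchanged). Then $G=_xG'$. (b) Symmetrically, suppose $D$ is a Right option of $G$ that has a Left option $D^L$ with $D^L\geq_xG$, and let $T,S,R,\dots$ be the Right options of $D^L$. Let $G''$ be obtained from $G$ by replacing the Right option $D$ by $T,S,R,\dots$. Then $G=_xG''$.
   Context: A (short) scoring play game is $G=\{G^L\mid G^S\mid G^R\}$ with finite sets $G^L,G^R$ of scoring play games (options) and score $G^S\in\mathbb{R}$, recursively, base case no options. Disjunctive sum: $G+_{\ell}H=\{G^L+_{\ell}H,\ G+_{\ell}H^L\mid G^S+H^S\mid G^R+_{\ell}H,\ G+_{\ell}H^R\}$; $G+_{\ell}c$ for $c\in\mathbb{R}$ means $G+_{\ell}\{\cdot\mid c\mid\cdot\}$ (add $c$ to every score). Final scores: $G_F^{SL}=G^S$ if $G^L=\emptyset$, else $\max_{G'\in G^L}G'^{SR}_F$; $G_F^{SR}=G^S$ if $G^R=\emptyset$, else $\min_{G'\in G^R}G'^{SL}_F$. $L_>,L_<,L_=$ (resp. $R_>,R_<,R_=$) are the games with $G_F^{SL}$ (resp. $G_F^{SR}$) $>0,<0,=0$; $L_\geq=L_>\cup L_=$, $L_\leq=L_<\cup L_=$, similarly $R_\geq,R_\leq$. Outcome classes: $\mathcal{L}=(L_>\cap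 R_>)\cup(L_>\cap R_=)\cup(L_=\cap R_>)$, $\mathcal{R}=(L_<\cap R_<)\cup(L_<\cap R_=)\cup(L_=\cap R_<)$, $\mathcal{N}=L_>\cap R_<$, $\mathcal{P}=L_<\cap R_>$, $\mathcal{T}=L_=\cap R_=$; $G\approx H$ means same outcome class. $\mathrm{Tame}_x$: $G\in\mathrm{Tame}_x$ iff $G^S=0$, every Left option is $A_0+_{\ell}x$ with $A_0\in\mathrm{Tame}_x$, every Right option is $B_0+_{\ell}(-x)$ with $B_0\in\mathrm{Tame}_x$ (so a Right option of a Left option of $G\in\mathrm{Tame}_x$ is, as a game tree, again in $\mathrm{Tame}_x$, and similarly a Left option of a Right option). For $G,H\in\mathrm{Tame}_x$: $G\geq_xH$ iff for every $X\in\mathrm{Tame}_x$ and every $O\in\{L_>,R_>,L_\geq,R_\geq\}$, $H+_{\ell}X\in O\Rightarrow G+_{\ell}X\in O$; $G\leq_xH$ iff for every $X\in\mathrm{Tame}_x$ and every $O\in\{L_<,R_<,L_\leq,R_\leq\}$, $H+_{\ell}X\in O\Rightarrow G+_{\ell}X\in O$; $G=_xH$ iff $G+_{\ell}X\approx H+_{\ell}X$ for all $X\in\mathrm{Tame}_x$. -}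

module Defs where

open import Level using (0ℓ)
open import Data.List using (List; []; _∷_; _++_)
open import Data.List.Relation.Unary.All using (All)
open import Data.List.Membership.Propositional using (_∈_)
open import Data.Product using (Σ; ∃; _×_; _,_)
open import Data.Sum using (_⊎_)
open import Relation.Nullary using (¬_)
open import Relation.Binary.PropositionalEquality using (_≡_)
open import Relation.Binary.Structures using (IsStrictTotalOrder)
open import Relation.Binary.Definitions using (Tri; tri<; tri≈; tri>)
open import Algebra.Structures using (IsCommutativeRing)
open import Function.Bundles using (_⇔_)

-- Every
-- model of this record is (classically) isomorphic to ℝ.

record RealField : Set₁ where
  infixl 6 _+_
  infixl 7 _*_
  infix  4 _<_
  field
    Carrier : Set
    _+_ _*_ : Carrier → Carrier → Carrier
    -_      : Carrier → Carrier
    0# 1#   : Carrier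
    _<_     : Carrier → Carrier → Set
    isCommutativeRing : IsCommutativeRing _≡_ _+_ _*_ -_ 0# 1#
    isStrictTotalOrder : IsStrictTotalOrder _≡_ _<_
    0<1     : 0# < 1#
    +-mono-< : ∀ {a b} c → a < b → a + c < b + c
    *-pos   : ∀ {a b} → 0# < a → 0# < b → 0# < a * b
    inverse : ∀ a → ¬ (a ≡ 0#) → ∃ λ b → a * b ≡ 1#

  _≤_ : Carrier → Carrier → Set
  a ≤ b = a < b ⊎ a ≡ b

  field
    complete : (P : Carrier → Set) → (∃ λ a → P a) →
               (∃ λ b → ∀ a → P a → a ≤ b) →
               ∃ λ s → (∀ a → P a → a ≤ s) ×
                       (∀ b → (∀ a → P a → a ≤ b) → s ≤ b)

module Scoring (ℝ : RealField) where
  open RealField ℝ public renaming (Carrier to R)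
  open IsStrictTotalOrder isStrictTotalOrder using (compare)

  max min : R → R → R
  max a b with compare a b
  ... | tri< _ _ _ = b
  ... | tri≈ _ _ _ = a
  ... | tri> _ _ _ = a
  min a b with compare a b
  ... | tri< _ _ _ = a
  ... | tri≈ _ _ _ = a
  ... | tri> _ _ _ = b

  -- G = { G^L | G^S | G^R }, finite option sets represented by lists
  data Game : Set where
    game : List Game → R → List Game → Game

  leftOpts rightOpts : Game → List Game
  leftOpts (game l _ _) = l
  rightOpts (game _ _ r) = r

  score : Game → R
  score (game _ s _) = s

  const : R → Game
  const c = game [] c []

  infixl 6 _+ℓ_
  mutual
    _+ℓ_ : Game → Game → Game
    G@(game GL s GR) +ℓ H@(game HL t HR) =
      game (sumL GL H ++ sumR G HL) (s + t) (sumL GR H ++ sumR G HR)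

    sumL : List Game → Game → List Game
    sumL [] H = []
    sumL (g ∷ gs) H = (g +ℓ H) ∷ sumL gs H

    sumR : Game → List Game → List Game
    sumR G [] = []
    sumR G (h ∷ hs) = (G +ℓ h) ∷ sumR G hs

  mutual
    finL : Game → R
    finL (game [] s _) = s
    finL (game (g ∷ gs) _ _) = maxFinR g gs

    finR : Game → R
    finR (game _ s []) = s
    finR (game _ _ (g ∷ gs)) = minFinL g gs

    maxFinR : Game → List Game → R
    maxFinR g [] = finR g
    maxFinR g (h ∷ hs) = max (finR g) (maxFinR h hs)

    minFinL : Game → List Game → R
    minFinL g [] = finL g
    minFinL g (h ∷ hs) = min (finL g) (minFinL h hs)

  L> L< L= R> R< R= L≥ L≤ R≥ R≤ : Game → Set
  L> G = 0# < finL G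
  L< G = finL G < 0#
  L= G = finL G ≡ 0#
  R> G = 0# < finR G
  R< G = finR G < 0#
  R= G = finR G ≡ 0#
  L≥ G = L> G ⊎ L= G
  L≤ G = L< G ⊎ L= G
  R≥ G = R> G ⊎ R= G
  R≤ G = R< G ⊎ R= G

  data Outcome : Set where
    𝓛 𝓡 𝓝 𝓟 𝓣 : Outcome

  _∈ₒ_ : Game → Outcome → Set
  G ∈ₒ 𝓛 = (L> G × R> G) ⊎ (L> G × R= G) ⊎ (L= G × R> G)
  G ∈ₒ 𝓡 = (L< G × R< G) ⊎ (L< G × R= G) ⊎ (L= G × R< G)
  G ∈ₒ 𝓝 = L> G × R< G
  G ∈ₒ 𝓟 = L< G × R> G
  G ∈ₒ 𝓣 = L= G × R= G

  _≈_ : Game → Game → Set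
  G ≈ H = ∀ o → (G ∈ₒ o) ⇔ (H ∈ₒ o)

  data Tame (x : R) : Game → Set where
    tame : ∀ {GL GR} →
           All (λ A → ∃ λ A₀ → Tame x A₀ × A ≡ A₀ +ℓ const x) GL →
           All (λ B → ∃ λ B₀ → Tame x B₀ × B ≡ B₀ +ℓ const (- x)) GR →
           Tame x (game GL 0# GR)

  _≥[_]_ : Game → R → Game → Set
  G ≥[ x ] H = ∀ X → Tame x X →
    (L> (H +ℓ X) → L> (G +ℓ X)) × (R> (H +ℓ X) → R> (G +ℓ X)) ×
    (L≥ (H +ℓ X) → L≥ (G +ℓ X)) × (R≥ (H +ℓ X) → R≥ (G +ℓ X))

  _≤[_]_ : Game → R → Game → Set
  G ≤[ x ] H = ∀ X → Tame x X →
    (L< (H +ℓ X) → L< (G +ℓ X)) × (R< (H +ℓ X) → R< (G +ℓ X)) ×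
    (L≤ (H +ℓ X) → L≤ (G +ℓ X)) × (R≤ (H +ℓ X) → R≤ (G +ℓ X))

  _=[_]_ : Game → R → Game → Set
  G =[ x ] H = ∀ X → Tame x X → (G +ℓ X) ≈ (H +ℓ X)

module Submission where

-- In a tame game every position reached by i Left and j Right moves has score (i − j) x, and
-- so does every position of G + X for tame X.  Hence the final scores of such a sum are 0 or
-- ± x according to whether the player to move wins the normal-play game on the same tree, and
-- =ₓ, ≤ₓ, ≥ₓ become statements about normal-play winners.  What remains is Conway's
-- reversibility of options, by induction on the tame X.  If Left wins G + X by moving to A + X,
-- then she also wins A^R + X moving first, and each winning move there is available in G′ + X:
-- a Left option of A^R directly, a move in X because A^R ≤ₓ G.  Conversely a winning move of
-- G′ + X to a Left option of A^R shows that Left wins A^R + X, hence G + X since A^R ≤ₓ G.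

open import Defs
open import Data.Bool using (Bool; true; false; not; _∨_; if_then_else_; T)
open import Data.Bool.Properties using (T?; if-not; ∨-identityʳ)
open import Data.Empty using (⊥-elim)
open import Data.List using (List; []; _∷_; _++_; map)
open import Data.List.Relation.Unary.All using (All; []; _∷_; lookup; tabulate)
import Data.List.Relation.Unary.All.Properties as All
open import Data.List.Relation.Unary.Any using (here; there)
open import Data.List.Relation.Binary.Pointwise using (Pointwise; []; _∷_; ++⁺)
open import Data.List.Membership.Propositional using (_∈_)
open import Data.List.Membership.Propositional.Properties
  using (∈-++⁺ˡ; ∈-++⁺ʳ; ∈-++⁻; ∈-map⁺; ∈-map⁻)
open import Data.Product using (∃; _×_; _,_; proj₁; proj₂)
import Data.Sum as Sum
open import Data.Sum using (_⊎_; inj₁; inj₂)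
open import Function using (_∘_; id)
open import Function.Bundles using (_⇔_; mk⇔; Equivalence)
open import Relation.Nullary using (¬_; yes; no)
open import Relation.Nullary.Decidable using (decidable-stable)
open import Relation.Binary.PropositionalEquality
open import Relation.Binary.Structures using (IsStrictTotalOrder)
open import Relation.Binary.Definitions using (tri<; tri≈; tri>)
open import Algebra.Structures using (IsCommutativeRing)

T-ext : ∀ {a b} → (T a → T b) → (T b → T a) → a ≡ b
T-ext {false} {false} _   _   = refl
T-ext {false} {true}  _   b→a = ⊥-elim (b→a _)
T-ext {true}  {false} a→b _   = ⊥-elim (a→b _)
T-ext {true}  {true}  _   _   = refl

module ScoringPlay (ℝ : RealField) where
  open Scoring ℝ public
  open Equivalence

  -- Normal play on the game tree, scores ignored: does the player who moves first win?
  mutual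
    leftWins : Game → Bool
    leftWins (game GL _ _) = anyRightLoses GL

    rightWins : Game → Bool
    rightWins (game _ _ GR) = anyLeftLoses GR

    anyRightLoses : List Game → Bool
    anyRightLoses [] = false
    anyRightLoses (G ∷ Gs) = not (rightWins G) ∨ anyRightLoses Gs

    anyLeftLoses : List Game → Bool
    anyLeftLoses [] = false
    anyLeftLoses (G ∷ Gs) = not (leftWins G) ∨ anyLeftLoses Gs

  anyRightLoses⁺ : ∀ {Z Gs} → Z ∈ Gs → ¬ T (rightWins Z) → T (anyRightLoses Gs)
  anyRightLoses⁺ {Z} (here refl) ¬w with rightWins Z
  ... | true  = ⊥-elim (¬w _)
  ... | false = _
  anyRightLoses⁺ {Gs = G ∷ _} (there Z∈) ¬w with rightWins G
  ... | true  = anyRightLoses⁺ Z∈ ¬w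
  ... | false = _

  anyLeftLoses⁺ : ∀ {Z Gs} → Z ∈ Gs → ¬ T (leftWins Z) → T (anyLeftLoses Gs)
  anyLeftLoses⁺ {Z} (here refl) ¬w with leftWins Z
  ... | true  = ⊥-elim (¬w _)
  ... | false = _
  anyLeftLoses⁺ {Gs = G ∷ _} (there Z∈) ¬w with leftWins G
  ... | true  = anyLeftLoses⁺ Z∈ ¬w
  ... | false = _

  anyRightLoses⁻ : ∀ Gs → T (anyRightLoses Gs) → ∃ λ Z → Z ∈ Gs × ¬ T (rightWins Z)
  anyRightLoses⁻ (G ∷ Gs) w with rightWins G in eq
  ... | false = G , here refl , subst T eq
  ... | true  = let Z , Z∈ , ¬w = anyRightLoses⁻ Gs w in Z , there Z∈ , ¬w

  anyLeftLoses⁻ : ∀ Gs → T (anyLeftLoses Gs) → ∃ λ Z → Z ∈ Gs × ¬ T (leftWins Z)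
  anyLeftLoses⁻ (G ∷ Gs) w with leftWins G in eq
  ... | false = G , here refl , subst T eq
  ... | true  = let Z , Z∈ , ¬w = anyLeftLoses⁻ Gs w in Z , there Z∈ , ¬w

  leftWins⁺ : ∀ {Z} H → Z ∈ leftOpts H → ¬ T (rightWins Z) → T (leftWins H)
  leftWins⁺ (game _ _ _) = anyRightLoses⁺

  rightWins⁺ : ∀ {Z} H → Z ∈ rightOpts H → ¬ T (leftWins Z) → T (rightWins H)
  rightWins⁺ (game _ _ _) = anyLeftLoses⁺

  leftWins⁻ : ∀ H → T (leftWins H) → ∃ λ Z → Z ∈ leftOpts H × ¬ T (rightWins Z)
  leftWins⁻ (game GL _ _) = anyRightLoses⁻ GL

  rightWins⁻ : ∀ H → T (rightWins H) → ∃ λ Z → Z ∈ rightOpts H × ¬ T (leftWins Z)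
  rightWins⁻ (game _ _ GR) = anyLeftLoses⁻ GR

  rightOption-leftWins : ∀ H {Z} → ¬ T (rightWins H) → Z ∈ rightOpts H → T (leftWins Z)
  rightOption-leftWins H ¬w Z∈ = decidable-stable (T? _) (¬w ∘ rightWins⁺ H Z∈)

  leftOption-rightWins : ∀ H {Z} → ¬ T (leftWins H) → Z ∈ leftOpts H → T (rightWins Z)
  leftOption-rightWins H ¬w Z∈ = decidable-stable (T? _) (¬w ∘ leftWins⁺ H Z∈)

  sumL≡map : ∀ Gs H → sumL Gs H ≡ map (_+ℓ H) Gs
  sumL≡map [] H = refl
  sumL≡map (G ∷ Gs) H = cong (G +ℓ H ∷_) (sumL≡map Gs H)

  sumR≡map : ∀ G Hs → sumR G Hs ≡ map (G +ℓ_) Hs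
  sumR≡map G [] = refl
  sumR≡map G (H ∷ Hs) = cong (G +ℓ H ∷_) (sumR≡map G Hs)

  leftOpts-+ℓ : ∀ G H →
    leftOpts (G +ℓ H) ≡ map (_+ℓ H) (leftOpts G) ++ map (G +ℓ_) (leftOpts H)
  leftOpts-+ℓ G@(game GL _ _) H@(game HL _ _) = cong₂ _++_ (sumL≡map GL H) (sumR≡map G HL)

  rightOpts-+ℓ : ∀ G H →
    rightOpts (G +ℓ H) ≡ map (_+ℓ H) (rightOpts G) ++ map (G +ℓ_) (rightOpts H)
  rightOpts-+ℓ G@(game _ _ GR) H@(game _ _ HR) = cong₂ _++_ (sumL≡map GR H) (sumR≡map G HR)

  ∈-leftOpts-+ℓˡ : ∀ {Z} G H → Z ∈ leftOpts G → Z +ℓ H ∈ leftOpts (G +ℓ H)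
  ∈-leftOpts-+ℓˡ G H Z∈ =
    subst (_ ∈_) (sym (leftOpts-+ℓ G H)) (∈-++⁺ˡ (∈-map⁺ (_+ℓ H) Z∈))

  ∈-leftOpts-+ℓʳ : ∀ {Y} G H → Y ∈ leftOpts H → G +ℓ Y ∈ leftOpts (G +ℓ H)
  ∈-leftOpts-+ℓʳ G H Y∈ =
    subst (_ ∈_) (sym (leftOpts-+ℓ G H)) (∈-++⁺ʳ _ (∈-map⁺ (G +ℓ_) Y∈))

  ∈-leftOpts-+ℓ⁻ : ∀ {P} G H → P ∈ leftOpts (G +ℓ H) →
    (∃ λ Z → Z ∈ leftOpts G × P ≡ Z +ℓ H) ⊎ (∃ λ Y → Y ∈ leftOpts H × P ≡ G +ℓ Y)
  ∈-leftOpts-+ℓ⁻ G H P∈ =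
    Sum.map (∈-map⁻ (_+ℓ H)) (∈-map⁻ (G +ℓ_)) (∈-++⁻ _ (subst (_ ∈_) (leftOpts-+ℓ G H) P∈))

  ∈-rightOpts-+ℓˡ : ∀ {Z} G H → Z ∈ rightOpts G → Z +ℓ H ∈ rightOpts (G +ℓ H)
  ∈-rightOpts-+ℓˡ G H Z∈ =
    subst (_ ∈_) (sym (rightOpts-+ℓ G H)) (∈-++⁺ˡ (∈-map⁺ (_+ℓ H) Z∈))

  ∈-rightOpts-+ℓʳ : ∀ {Y} G H → Y ∈ rightOpts H → G +ℓ Y ∈ rightOpts (G +ℓ H)
  ∈-rightOpts-+ℓʳ G H Y∈ =
    subst (_ ∈_) (sym (rightOpts-+ℓ G H)) (∈-++⁺ʳ _ (∈-map⁺ (G +ℓ_) Y∈))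

  ∈-rightOpts-+ℓ⁻ : ∀ {P} G H → P ∈ rightOpts (G +ℓ H) →
    (∃ λ Z → Z ∈ rightOpts G × P ≡ Z +ℓ H) ⊎ (∃ λ Y → Y ∈ rightOpts H × P ≡ G +ℓ Y)
  ∈-rightOpts-+ℓ⁻ G H P∈ =
    Sum.map (∈-map⁻ (_+ℓ H)) (∈-map⁻ (G +ℓ_)) (∈-++⁻ _ (subst (_ ∈_) (rightOpts-+ℓ G H) P∈))

  leftWins-+ℓˡ : ∀ G H {Z} → Z ∈ leftOpts G → ¬ T (rightWins (Z +ℓ H)) → T (leftWins (G +ℓ H))
  leftWins-+ℓˡ G H Z∈ = leftWins⁺ (G +ℓ H) (∈-leftOpts-+ℓˡ G H Z∈)

  rightWins-+ℓˡ : ∀ G H {Z} → Z ∈ rightOpts G → ¬ T (leftWins (Z +ℓ H)) → T (rightWins (G +ℓ H))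
  rightWins-+ℓˡ G H Z∈ = rightWins⁺ (G +ℓ H) (∈-rightOpts-+ℓˡ G H Z∈)

  leftWins-transfer : ∀ G G′ X →
    (∀ {Z} → Z ∈ leftOpts G → ¬ T (rightWins (Z +ℓ X)) → T (leftWins (G′ +ℓ X))) →
    (∀ {Y} → Y ∈ leftOpts X → ¬ T (rightWins (G +ℓ Y)) → ¬ T (rightWins (G′ +ℓ Y))) →
    T (leftWins (G +ℓ X)) → T (leftWins (G′ +ℓ X))
  leftWins-transfer G G′ X answerInG answerInX w with leftWins⁻ (G +ℓ X) w
  ... | P , P∈ , ¬wP with ∈-leftOpts-+ℓ⁻ G X P∈
  ... | inj₁ (Z , Z∈ , refl) = answerInG Z∈ ¬wP
  ... | inj₂ (Y , Y∈ , refl) =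
    leftWins⁺ (G′ +ℓ X) (∈-leftOpts-+ℓʳ G′ X Y∈) (answerInX Y∈ ¬wP)

  rightWins-transfer : ∀ G G′ X →
    (∀ {Z} → Z ∈ rightOpts G → ¬ T (leftWins (Z +ℓ X)) → T (rightWins (G′ +ℓ X))) →
    (∀ {Y} → Y ∈ rightOpts X → ¬ T (leftWins (G +ℓ Y)) → ¬ T (leftWins (G′ +ℓ Y))) →
    T (rightWins (G +ℓ X)) → T (rightWins (G′ +ℓ X))
  rightWins-transfer G G′ X answerInG answerInX w with rightWins⁻ (G +ℓ X) w
  ... | P , P∈ , ¬wP with ∈-rightOpts-+ℓ⁻ G X P∈
  ... | inj₁ (Z , Z∈ , refl) = answerInG Z∈ ¬wP
  ... | inj₂ (Y , Y∈ , refl) =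
    rightWins⁺ (G′ +ℓ X) (∈-rightOpts-+ℓʳ G′ X Y∈) (answerInX Y∈ ¬wP)

  leftWins-sameLeftOpts : ∀ G G′ X → leftOpts G ≡ leftOpts G′ →
    (∀ {Y} → Y ∈ leftOpts X → rightWins (G +ℓ Y) ≡ rightWins (G′ +ℓ Y)) →
    leftWins (G +ℓ X) ≡ leftWins (G′ +ℓ X)
  leftWins-sameLeftOpts G G′ X same ih = T-ext
    (leftWins-transfer G G′ X (λ Z∈ → leftWins-+ℓˡ G′ X (subst (_ ∈_) same Z∈))
                              (λ Y∈ → subst (¬_ ∘ T) (ih Y∈)))
    (leftWins-transfer G′ G X (λ Z∈ → leftWins-+ℓˡ G X (subst (_ ∈_) (sym same) Z∈))
                              (λ Y∈ → subst (¬_ ∘ T) (sym (ih Y∈))))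

  rightWins-sameRightOpts : ∀ G G′ X → rightOpts G ≡ rightOpts G′ →
    (∀ {Y} → Y ∈ rightOpts X → leftWins (G +ℓ Y) ≡ leftWins (G′ +ℓ Y)) →
    rightWins (G +ℓ X) ≡ rightWins (G′ +ℓ X)
  rightWins-sameRightOpts G G′ X same ih = T-ext
    (rightWins-transfer G G′ X (λ Z∈ → rightWins-+ℓˡ G′ X (subst (_ ∈_) same Z∈))
                               (λ Y∈ → subst (¬_ ∘ T) (ih Y∈)))
    (rightWins-transfer G′ G X (λ Z∈ → rightWins-+ℓˡ G X (subst (_ ∈_) (sym same) Z∈))
                               (λ Y∈ → subst (¬_ ∘ T) (sym (ih Y∈))))

  data _≅_ : Game → Game → Set where
    game≅ : ∀ {GL GR HL HR s t} → Pointwise _≅_ GL HL → Pointwise _≅_ GR HR →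
            game GL s GR ≅ game HL t HR

  mutual
    leftWins-≅ : ∀ {G H} → G ≅ H → leftWins G ≡ leftWins H
    leftWins-≅ (game≅ pL _) = anyRightLoses-≅ pL

    rightWins-≅ : ∀ {G H} → G ≅ H → rightWins G ≡ rightWins H
    rightWins-≅ (game≅ _ pR) = anyLeftLoses-≅ pR

    anyRightLoses-≅ : ∀ {Gs Hs} → Pointwise _≅_ Gs Hs → anyRightLoses Gs ≡ anyRightLoses Hs
    anyRightLoses-≅ [] = refl
    anyRightLoses-≅ (p ∷ ps) = cong₂ (λ b c → not b ∨ c) (rightWins-≅ p) (anyRightLoses-≅ ps)

    anyLeftLoses-≅ : ∀ {Gs Hs} → Pointwise _≅_ Gs Hs → anyLeftLoses Gs ≡ anyLeftLoses Hs
    anyLeftLoses-≅ [] = refl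
    anyLeftLoses-≅ (p ∷ ps) = cong₂ (λ b c → not b ∨ c) (leftWins-≅ p) (anyLeftLoses-≅ ps)

  mutual
    +ℓ-congˡ-≅ : ∀ G {H H′} → H ≅ H′ → (G +ℓ H) ≅ (G +ℓ H′)
    +ℓ-congˡ-≅ G@(game GL _ GR) p@(game≅ pL pR) =
      game≅ (++⁺ (sumL-≅ GL p) (sumR-≅ G pL)) (++⁺ (sumL-≅ GR p) (sumR-≅ G pR))

    sumL-≅ : ∀ Gs {H H′} → H ≅ H′ → Pointwise _≅_ (sumL Gs H) (sumL Gs H′)
    sumL-≅ [] p = []
    sumL-≅ (G ∷ Gs) p = +ℓ-congˡ-≅ G p ∷ sumL-≅ Gs p

    sumR-≅ : ∀ G {Hs Hs′} → Pointwise _≅_ Hs Hs′ → Pointwise _≅_ (sumR G Hs) (sumR G Hs′)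
    sumR-≅ G [] = []
    sumR-≅ G (p ∷ ps) = +ℓ-congˡ-≅ G p ∷ sumR-≅ G ps

  mutual
    +ℓ-const-≅ : ∀ G c → (G +ℓ const c) ≅ G
    +ℓ-const-≅ (game GL _ GR) c = game≅ (sumL-const-≅ GL c) (sumL-const-≅ GR c)

    sumL-const-≅ : ∀ Gs c → Pointwise _≅_ (sumL Gs (const c) ++ []) Gs
    sumL-const-≅ [] c = []
    sumL-const-≅ (G ∷ Gs) c = +ℓ-const-≅ G c ∷ sumL-const-≅ Gs c

  leftWins-+ℓ-const : ∀ G Y c → leftWins (G +ℓ (Y +ℓ const c)) ≡ leftWins (G +ℓ Y)
  leftWins-+ℓ-const G Y c = leftWins-≅ (+ℓ-congˡ-≅ G (+ℓ-const-≅ Y c))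

  rightWins-+ℓ-const : ∀ G Y c → rightWins (G +ℓ (Y +ℓ const c)) ≡ rightWins (G +ℓ Y)
  rightWins-+ℓ-const G Y c = rightWins-≅ (+ℓ-congˡ-≅ G (+ℓ-const-≅ Y c))

  SameWinners : Game → Game → Set
  SameWinners G H = leftWins G ≡ leftWins H × rightWins G ≡ rightWins H

  sameWinners-+ℓ-const : ∀ G G′ Y c → SameWinners (G +ℓ Y) (G′ +ℓ Y) →
    SameWinners (G +ℓ (Y +ℓ const c)) (G′ +ℓ (Y +ℓ const c))
  sameWinners-+ℓ-const G G′ Y c (sameL , sameR) =
    trans (leftWins-+ℓ-const G Y c) (trans sameL (sym (leftWins-+ℓ-const G′ Y c))) ,
    trans (rightWins-+ℓ-const G Y c) (trans sameR (sym (rightWins-+ℓ-const G′ Y c)))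

  Replacing : List Game → List Game → Game → List Game → Set
  Replacing Gs′ Gs A As = ∀ Z → Z ∈ Gs′ ⇔ ((Z ∈ Gs × ¬ Z ≡ A) ⊎ Z ∈ As)

  All-replacing : ∀ {P : Game → Set} {Gs′ Gs A As} →
    Replacing Gs′ Gs A As → All P Gs → All P As → All P Gs′
  All-replacing spec pGs pAs =
    tabulate (λ Z∈ → Sum.[ lookup pGs ∘ proj₁ , lookup pAs ] (to (spec _) Z∈))

  module TameGames (x : R) where

    tame-leftOption : ∀ {X Y} → Tame x X → Y ∈ leftOpts X →
      ∃ λ Y₀ → Tame x Y₀ × Y ≡ Y₀ +ℓ const x
    tame-leftOption (tame al _) = lookup al

    tame-rightOption : ∀ {X Y} → Tame x X → Y ∈ rightOpts X →
      ∃ λ Y₀ → Tame x Y₀ × Y ≡ Y₀ +ℓ const (- x)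
    tame-rightOption (tame _ ar) = lookup ar

    tame-induction : (P : Game → Set) → (∀ {Y} c → P Y → P (Y +ℓ const c)) →
      (∀ {X} → Tame x X →
         (∀ {Y} → Y ∈ leftOpts X → P Y) → (∀ {Y} → Y ∈ rightOpts X → P Y) → P X) →
      ∀ {X} → Tame x X → P X
    tame-induction P shift step = induct
      where
      mutual
        induct : ∀ {X} → Tame x X → P X
        induct tX@(tame al ar) = step tX (lookup (options al)) (lookup (options ar))

        options : ∀ {c Ys} → All (λ Y → ∃ λ Y₀ → Tame x Y₀ × Y ≡ Y₀ +ℓ const c) Ys → All P Ys
        options [] = []
        options ((Y₀ , tY₀ , refl) ∷ ps) = shift _ (induct tY₀) ∷ options ps

    _≤ʷ_ : Game → Game → Set
    H ≤ʷ K = ∀ {X} → Tame x X →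
      (T (leftWins (H +ℓ X)) → T (leftWins (K +ℓ X))) ×
      (T (rightWins (K +ℓ X)) → T (rightWins (H +ℓ X)))

    module LeftReversal {GL GR L′ : List Game} {s s′ : R} {A AR : Game}
        (AR∈ : AR ∈ rightOpts A) (L′-spec : Replacing L′ GL A (leftOpts AR))
        (AR≤G : AR ≤ʷ game GL s GR) where

      G G′ : Game
      G  = game GL s GR
      G′ = game L′ s′ GR

      inductionStep : ∀ {X} → Tame x X →
        (∀ {Y} → Y ∈ leftOpts X → SameWinners (G +ℓ Y) (G′ +ℓ Y)) →
        (∀ {Y} → Y ∈ rightOpts X → SameWinners (G +ℓ Y) (G′ +ℓ Y)) →
        SameWinners (G +ℓ X) (G′ +ℓ X)
      inductionStep {X} tX ihL ihR =
        T-ext left→ left← , rightWins-sameRightOpts G G′ X refl (proj₁ ∘ ihR)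
        where
        left← : T (leftWins (G′ +ℓ X)) → T (leftWins (G +ℓ X))
        left← = leftWins-transfer G′ G X answer (λ Y∈ → subst (¬_ ∘ T) (sym (proj₂ (ihL Y∈))))
          where
          answer : ∀ {Z} → Z ∈ L′ → ¬ T (rightWins (Z +ℓ X)) → T (leftWins (G +ℓ X))
          answer {Z} Z∈ ¬w with to (L′-spec Z) Z∈
          ... | inj₁ (Z∈GL , _) = leftWins-+ℓˡ G X Z∈GL ¬w
          ... | inj₂ Z∈ARᴸ      = proj₁ (AR≤G tX) (leftWins-+ℓˡ AR X Z∈ARᴸ ¬w)

        reverse : ¬ T (rightWins (A +ℓ X)) → T (leftWins (G′ +ℓ X))
        reverse ¬wA =
          leftWins-transfer AR G′ X (λ W∈ → leftWins-+ℓˡ G′ X (from (L′-spec _) (inj₂ W∈))) viaG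
            (rightOption-leftWins (A +ℓ X) ¬wA (∈-rightOpts-+ℓˡ A X AR∈))
          where
          viaG : ∀ {Y} → Y ∈ leftOpts X → ¬ T (rightWins (AR +ℓ Y)) → ¬ T (rightWins (G′ +ℓ Y))
          viaG Y∈ ¬wAR with tame-leftOption tX Y∈
          ... | Y₀ , tY₀ , refl =
            subst (¬_ ∘ T) (proj₂ (ihL Y∈))
              (subst (¬_ ∘ T) (sym (rightWins-+ℓ-const G Y₀ x))
                (¬wAR ∘ subst T (sym (rightWins-+ℓ-const AR Y₀ x)) ∘ proj₂ (AR≤G tY₀)))

        -- Game equality is undecidable, so instead of testing Z ≡ A we ask whether Left
        -- already wins G′ + X.
        left→ : T (leftWins (G +ℓ X)) → T (leftWins (G′ +ℓ X))
        left→ = leftWins-transfer G G′ X answer (λ Y∈ → subst (¬_ ∘ T) (proj₂ (ihL Y∈)))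
          where
          answer : ∀ {Z} → Z ∈ GL → ¬ T (rightWins (Z +ℓ X)) → T (leftWins (G′ +ℓ X))
          answer {Z} Z∈ ¬w with T? (leftWins (G′ +ℓ X))
          ... | yes w  = w
          ... | no ¬w′ =
            leftWins-+ℓˡ G′ X (from (L′-spec Z) (inj₁ (Z∈ , λ { refl → ¬w′ (reverse ¬w) }))) ¬w

      sameWinners : ∀ {X} → Tame x X → SameWinners (G +ℓ X) (G′ +ℓ X)
      sameWinners = tame-induction (λ X → SameWinners (G +ℓ X) (G′ +ℓ X))
                                   (λ {Y} → sameWinners-+ℓ-const G G′ Y) inductionStep

    module RightReversal {GL GR R′ : List Game} {s s′ : R} {D DL : Game}
        (DL∈ : DL ∈ leftOpts D) (R′-spec : Replacing R′ GR D (rightOpts DL))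
        (G≤DL : game GL s GR ≤ʷ DL) where

      G G′ : Game
      G  = game GL s GR
      G′ = game GL s′ R′

      inductionStep : ∀ {X} → Tame x X →
        (∀ {Y} → Y ∈ leftOpts X → SameWinners (G +ℓ Y) (G′ +ℓ Y)) →
        (∀ {Y} → Y ∈ rightOpts X → SameWinners (G +ℓ Y) (G′ +ℓ Y)) →
        SameWinners (G +ℓ X) (G′ +ℓ X)
      inductionStep {X} tX ihL ihR =
        leftWins-sameLeftOpts G G′ X refl (proj₂ ∘ ihL) , T-ext right→ right←
        where
        right← : T (rightWins (G′ +ℓ X)) → T (rightWins (G +ℓ X))
        right← = rightWins-transfer G′ G X answer (λ Y∈ → subst (¬_ ∘ T) (sym (proj₁ (ihR Y∈))))
          where
          answer : ∀ {Z} → Z ∈ R′ → ¬ T (leftWins (Z +ℓ X)) → T (rightWins (G +ℓ X))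
          answer {Z} Z∈ ¬w with to (R′-spec Z) Z∈
          ... | inj₁ (Z∈GR , _) = rightWins-+ℓˡ G X Z∈GR ¬w
          ... | inj₂ Z∈DLᴿ      = proj₂ (G≤DL tX) (rightWins-+ℓˡ DL X Z∈DLᴿ ¬w)

        reverse : ¬ T (leftWins (D +ℓ X)) → T (rightWins (G′ +ℓ X))
        reverse ¬wD =
          rightWins-transfer DL G′ X (λ W∈ → rightWins-+ℓˡ G′ X (from (R′-spec _) (inj₂ W∈))) viaG
            (leftOption-rightWins (D +ℓ X) ¬wD (∈-leftOpts-+ℓˡ D X DL∈))
          where
          viaG : ∀ {Y} → Y ∈ rightOpts X → ¬ T (leftWins (DL +ℓ Y)) → ¬ T (leftWins (G′ +ℓ Y))
          viaG Y∈ ¬wDL with tame-rightOption tX Y∈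
          ... | Y₀ , tY₀ , refl =
            subst (¬_ ∘ T) (proj₁ (ihR Y∈))
              (subst (¬_ ∘ T) (sym (leftWins-+ℓ-const G Y₀ (- x)))
                (¬wDL ∘ subst T (sym (leftWins-+ℓ-const DL Y₀ (- x))) ∘ proj₁ (G≤DL tY₀)))

        right→ : T (rightWins (G +ℓ X)) → T (rightWins (G′ +ℓ X))
        right→ = rightWins-transfer G G′ X answer (λ Y∈ → subst (¬_ ∘ T) (proj₁ (ihR Y∈)))
          where
          answer : ∀ {Z} → Z ∈ GR → ¬ T (leftWins (Z +ℓ X)) → T (rightWins (G′ +ℓ X))
          answer {Z} Z∈ ¬w with T? (rightWins (G′ +ℓ X))
          ... | yes w  = w
          ... | no ¬w′ =
            rightWins-+ℓˡ G′ X (from (R′-spec Z) (inj₁ (Z∈ , λ { refl → ¬w′ (reverse ¬w) }))) ¬w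

      sameWinners : ∀ {X} → Tame x X → SameWinners (G +ℓ X) (G′ +ℓ X)
      sameWinners = tame-induction (λ X → SameWinners (G +ℓ X) (G′ +ℓ X))
                                   (λ {Y} → sameWinners-+ℓ-const G G′ Y) inductionStep

  ≈-fromFinals : ∀ {G H} → finL G ≡ finL H → finR G ≡ finR H → G ≈ H
  ≈-fromFinals eL eR 𝓛 rewrite eL | eR = mk⇔ id id
  ≈-fromFinals eL eR 𝓡 rewrite eL | eR = mk⇔ id id
  ≈-fromFinals eL eR 𝓝 rewrite eL | eR = mk⇔ id id
  ≈-fromFinals eL eR 𝓟 rewrite eL | eR = mk⇔ id id
  ≈-fromFinals eL eR 𝓣 rewrite eL | eR = mk⇔ id id

  open IsStrictTotalOrder isStrictTotalOrder using (compare; irrefl; asym)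

  max-idem : ∀ a → max a a ≡ a
  max-idem a with compare a a
  ... | tri< _ a≢a _ = ⊥-elim (a≢a refl)
  ... | tri≈ _ _ _   = refl
  ... | tri> _ a≢a _ = ⊥-elim (a≢a refl)

  max-< : ∀ {a b} → a < b → max a b ≡ b
  max-< {a} {b} a<b with compare a b
  ... | tri< _ _ _   = refl
  ... | tri≈ _ a≡b _ = ⊥-elim (irrefl a≡b a<b)
  ... | tri> _ _ b<a = ⊥-elim (asym a<b b<a)

  max-> : ∀ {a b} → b < a → max a b ≡ a
  max-> {a} {b} b<a with compare a b
  ... | tri< a<b _ _ = ⊥-elim (asym a<b b<a)
  ... | tri≈ _ _ _   = refl
  ... | tri> _ _ _   = refl

  min-idem : ∀ a → min a a ≡ a
  min-idem a with compare a a
  ... | tri< _ _ _   = refl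
  ... | tri≈ _ _ _   = refl
  ... | tri> _ a≢a _ = ⊥-elim (a≢a refl)

  min-< : ∀ {a b} → a < b → min a b ≡ a
  min-< {a} {b} a<b with compare a b
  ... | tri< _ _ _   = refl
  ... | tri≈ _ _ _   = refl
  ... | tri> _ _ b<a = ⊥-elim (asym a<b b<a)

  min-> : ∀ {a b} → b < a → min a b ≡ b
  min-> {a} {b} b<a with compare a b
  ... | tri< a<b _ _ = ⊥-elim (asym a<b b<a)
  ... | tri≈ _ a≡b _ = ⊥-elim (irrefl (sym a≡b) b<a)
  ... | tri> _ _ _   = refl

  max-if : ∀ {lo hi} → lo < hi → ∀ a b →
    max (if a then hi else lo) (if b then hi else lo) ≡ (if a ∨ b then hi else lo)
  max-if {lo} {hi} _     true  true  = max-idem hi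
  max-if           lo<hi true  false = max-> lo<hi
  max-if           lo<hi false true  = max-< lo<hi
  max-if {lo}      _     false false = max-idem lo

  min-if : ∀ {lo hi} → lo < hi → ∀ a b →
    min (if a then lo else hi) (if b then lo else hi) ≡ (if a ∨ b then lo else hi)
  min-if {lo}      _     true  true  = min-idem lo
  min-if           lo<hi true  false = min-< lo<hi
  min-if           lo<hi false true  = min-> lo<hi
  min-if {_} {hi}  _     false false = min-idem hi

  open IsCommutativeRing isCommutativeRing
    using (+-assoc; +-comm; +-identityˡ; +-identityʳ; -‿inverseˡ; -‿inverseʳ)

  +-swapʳ : ∀ a b c → (a + b) + c ≡ (a + c) + b
  +-swapʳ a b c = begin
    (a + b) + c ≡⟨ +-assoc a b c ⟩
    a + (b + c) ≡⟨ cong (a +_) (+-comm b c) ⟩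
    a + (c + b) ≡⟨ +-assoc a c b ⟨
    (a + c) + b ∎
    where open ≡-Reasoning

  module Levels (x : R) (0<x : 0# < x) where
    open TameGames x

    c+x-x≡c : ∀ c → (c + x) + - x ≡ c
    c+x-x≡c c = trans (+-assoc c x (- x)) (trans (cong (c +_) (-‿inverseʳ x)) (+-identityʳ c))

    c-x+x≡c : ∀ c → (c + - x) + x ≡ c
    c-x+x≡c c = trans (+-assoc c (- x) x) (trans (cong (c +_) (-‿inverseˡ x)) (+-identityʳ c))

    c<c+x : ∀ c → c < c + x
    c<c+x c = subst₂ _<_ (+-identityˡ c) (+-comm x c) (+-mono-< c 0<x)

    c-x<c : ∀ c → c + - x < c
    c-x<c c = subst (c + - x <_) (c-x+x≡c c) (c<c+x (c + - x))

    data Levelled : R → Game → Set where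
      levelled : ∀ {c GL GR} → All (Levelled (c + x)) GL → All (Levelled (c + - x)) GR →
                 Levelled c (game GL c GR)

    levelled-≡ : ∀ {c d G} → c ≡ d → Levelled c G → Levelled d G
    levelled-≡ refl p = p

    All-levelled-≡ : ∀ {c d Gs} → c ≡ d → All (Levelled c) Gs → All (Levelled d) Gs
    All-levelled-≡ refl ps = ps

    leftOpts-levelled : ∀ {c G} → Levelled c G → All (Levelled (c + x)) (leftOpts G)
    leftOpts-levelled (levelled pL _) = pL

    rightOpts-levelled : ∀ {c G} → Levelled c G → All (Levelled (c + - x)) (rightOpts G)
    rightOpts-levelled (levelled _ pR) = pR

    levelled-leftRightOption : ∀ {c G A AR} →
      Levelled c G → A ∈ leftOpts G → AR ∈ rightOpts A → Levelled c AR
    levelled-leftRightOption pG A∈ AR∈ =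
      levelled-≡ (c+x-x≡c _) (lookup (rightOpts-levelled (lookup (leftOpts-levelled pG) A∈)) AR∈)

    levelled-rightLeftOption : ∀ {c G D DL} →
      Levelled c G → D ∈ rightOpts G → DL ∈ leftOpts D → Levelled c DL
    levelled-rightLeftOption pG D∈ DL∈ =
      levelled-≡ (c-x+x≡c _) (lookup (leftOpts-levelled (lookup (rightOpts-levelled pG) D∈)) DL∈)

    mutual
      levelled-+ℓ : ∀ {c d G H} → Levelled c G → Levelled d H → Levelled (c + d) (G +ℓ H)
      levelled-+ℓ {c} {d} pG@(levelled pGL pGR) pH@(levelled pHL pHR) =
        levelled
          (All.++⁺ (All-levelled-≡ (+-swapʳ c x d) (sumL-levelled pGL pH))
                   (All-levelled-≡ (sym (+-assoc c d x)) (sumR-levelled pG pHL)))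
          (All.++⁺ (All-levelled-≡ (+-swapʳ c (- x) d) (sumL-levelled pGR pH))
                   (All-levelled-≡ (sym (+-assoc c d (- x))) (sumR-levelled pG pHR)))

      sumL-levelled : ∀ {e d Gs H} →
        All (Levelled e) Gs → Levelled d H → All (Levelled (e + d)) (sumL Gs H)
      sumL-levelled [] pH = []
      sumL-levelled (pG ∷ pGs) pH = levelled-+ℓ pG pH ∷ sumL-levelled pGs pH

      sumR-levelled : ∀ {c e G Hs} →
        Levelled c G → All (Levelled e) Hs → All (Levelled (c + e)) (sumR G Hs)
      sumR-levelled pG [] = []
      sumR-levelled pG (pH ∷ pHs) = levelled-+ℓ pG pH ∷ sumR-levelled pG pHs

    mutual
      tame⇒levelled : ∀ {G} → Tame x G → Levelled 0# G
      tame⇒levelled (tame al ar) = levelled (shifted al) (shifted ar)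

      shifted : ∀ {c Gs} →
        All (λ A → ∃ λ A₀ → Tame x A₀ × A ≡ A₀ +ℓ const c) Gs → All (Levelled (0# + c)) Gs
      shifted [] = []
      shifted ((A₀ , tA₀ , refl) ∷ ps) = levelled-+ℓ (tame⇒levelled tA₀) (levelled [] []) ∷ shifted ps

    levelled-+ℓ-tame : ∀ {G X} → Levelled 0# G → Tame x X → Levelled 0# (G +ℓ X)
    levelled-+ℓ-tame pG tX = levelled-≡ (+-identityʳ 0#) (levelled-+ℓ pG (tame⇒levelled tX))

    mutual
      finL-levelled : ∀ {c G} → Levelled c G → finL G ≡ (if leftWins G then c + x else c)
      finL-levelled (levelled [] _) = refl
      finL-levelled (levelled (p ∷ ps) _) = maxFinR-levelled p ps

      finR-levelled : ∀ {c G} → Levelled c G → finR G ≡ (if rightWins G then c + - x else c)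
      finR-levelled (levelled _ []) = refl
      finR-levelled (levelled _ (p ∷ ps)) = minFinL-levelled p ps

      finR-leftOption : ∀ {c G} → Levelled (c + x) G →
        finR G ≡ (if not (rightWins G) then c + x else c)
      finR-leftOption {c} {G} p = begin
        finR G                                          ≡⟨ finR-levelled p ⟩
        (if rightWins G then (c + x) + - x else c + x)  ≡⟨ cong (λ a → if rightWins G then a else c + x)
                                                                (c+x-x≡c c) ⟩
        (if rightWins G then c else c + x)              ≡⟨ if-not (rightWins G) ⟨
        (if not (rightWins G) then c + x else c)        ∎
        where open ≡-Reasoning

      finL-rightOption : ∀ {c G} → Levelled (c + - x) G →
        finL G ≡ (if not (leftWins G) then c + - x else c)
      finL-rightOption {c} {G} p = begin
        finL G                                           ≡⟨ finL-levelled p ⟩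
        (if leftWins G then (c + - x) + x else c + - x)  ≡⟨ cong (λ a → if leftWins G then a else c + - x)
                                                                 (c-x+x≡c c) ⟩
        (if leftWins G then c else c + - x)              ≡⟨ if-not (leftWins G) ⟨
        (if not (leftWins G) then c + - x else c)        ∎
        where open ≡-Reasoning

      maxFinR-levelled : ∀ {c G Gs} → Levelled (c + x) G → All (Levelled (c + x)) Gs →
        maxFinR G Gs ≡ (if anyRightLoses (G ∷ Gs) then c + x else c)
      maxFinR-levelled {c} {G} p [] =
        trans (finR-leftOption p)
              (cong (λ b → if b then c + x else c) (sym (∨-identityʳ (not (rightWins G)))))
      maxFinR-levelled {c} {G} {H ∷ Hs} p (q ∷ qs) =
        trans (cong₂ max (finR-leftOption p) (maxFinR-levelled q qs))
              (max-if (c<c+x c) (not (rightWins G)) (anyRightLoses (H ∷ Hs)))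

      minFinL-levelled : ∀ {c G Gs} → Levelled (c + - x) G → All (Levelled (c + - x)) Gs →
        minFinL G Gs ≡ (if anyLeftLoses (G ∷ Gs) then c + - x else c)
      minFinL-levelled {c} {G} p [] =
        trans (finL-rightOption p)
              (cong (λ b → if b then c + - x else c) (sym (∨-identityʳ (not (leftWins G)))))
      minFinL-levelled {c} {G} {H ∷ Hs} p (q ∷ qs) =
        trans (cong₂ min (finL-rightOption p) (minFinL-levelled q qs))
              (min-if (c-x<c c) (not (leftWins G)) (anyLeftLoses (H ∷ Hs)))

    ≈-fromSameWinners : ∀ {c G H} → Levelled c G → Levelled c H → SameWinners G H → G ≈ H
    ≈-fromSameWinners {c} pG pH (sameL , sameR) = ≈-fromFinals
      (trans (finL-levelled pG) (trans (cong (λ b → if b then c + x else c) sameL)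
                                       (sym (finL-levelled pH))))
      (trans (finR-levelled pG) (trans (cong (λ b → if b then c + - x else c) sameR)
                                       (sym (finR-levelled pH))))

    L>⇔leftWins : ∀ {G} → Levelled 0# G → L> G ⇔ T (leftWins G)
    L>⇔leftWins {G} p rewrite finL-levelled p with leftWins G
    ... | true  = mk⇔ _ (λ _ → c<c+x 0#)
    ... | false = mk⇔ (irrefl refl) (λ ())

    L≤⇔¬leftWins : ∀ {G} → Levelled 0# G → L≤ G ⇔ (¬ T (leftWins G))
    L≤⇔¬leftWins {G} p rewrite finL-levelled p with leftWins G
    ... | true  = mk⇔ (λ { (inj₁ x<0) _ → asym (c<c+x 0#) x<0
                         ; (inj₂ x≡0) _ → irrefl (sym x≡0) (c<c+x 0#) })
                      (λ ¬t → ⊥-elim (¬t _))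
    ... | false = mk⇔ (λ _ ()) (λ _ → inj₂ refl)

    R<⇔rightWins : ∀ {G} → Levelled 0# G → R< G ⇔ T (rightWins G)
    R<⇔rightWins {G} p rewrite finR-levelled p with rightWins G
    ... | true  = mk⇔ _ (λ _ → c-x<c 0#)
    ... | false = mk⇔ (irrefl refl) (λ ())

    R≥⇔¬rightWins : ∀ {G} → Levelled 0# G → R≥ G ⇔ (¬ T (rightWins G))
    R≥⇔¬rightWins {G} p rewrite finR-levelled p with rightWins G
    ... | true  = mk⇔ (λ { (inj₁ 0<-x) _ → asym (c-x<c 0#) 0<-x
                         ; (inj₂ -x≡0) _ → irrefl -x≡0 (c-x<c 0#) })
                      (λ ¬t → ⊥-elim (¬t _))
    ... | false = mk⇔ (λ _ ()) (λ _ → inj₂ refl)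

    ≤ₓ⇒≤ʷ : ∀ {H K} → Levelled 0# H → Levelled 0# K → H ≤[ x ] K → H ≤ʷ K
    ≤ₓ⇒≤ʷ pH pK H≤K {X} tX =
      let _ , R<⇒ , L≤⇒ , _ = H≤K X tX
          pHX = levelled-+ℓ-tame pH tX
          pKX = levelled-+ℓ-tame pK tX
      in (λ wH → decidable-stable (T? _) λ ¬wK →
            to (L≤⇔¬leftWins pHX) (L≤⇒ (from (L≤⇔¬leftWins pKX) ¬wK)) wH)
       , to (R<⇔rightWins pHX) ∘ R<⇒ ∘ from (R<⇔rightWins pKX)

    ≥ₓ⇒≤ʷ : ∀ {H K} → Levelled 0# H → Levelled 0# K → H ≥[ x ] K → K ≤ʷ H
    ≥ₓ⇒≤ʷ pH pK H≥K {X} tX =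
      let L>⇒ , _ , _ , R≥⇒ = H≥K X tX
          pHX = levelled-+ℓ-tame pH tX
          pKX = levelled-+ℓ-tame pK tX
      in to (L>⇔leftWins pHX) ∘ L>⇒ ∘ from (L>⇔leftWins pKX)
       , (λ wH → decidable-stable (T? _) λ ¬wK →
            to (R≥⇔¬rightWins pHX) (R≥⇒ (from (R≥⇔¬rightWins pKX) ¬wK)) wH)

mainTheorem5 : (ℝ : RealField) → let open Scoring ℝ in
    ∀ (x : R) → 0# < x → ∀ (G : Game) → Tame x G →
    (∀ A → A ∈ leftOpts G → ∀ AR → AR ∈ rightOpts A → AR ≤[ x ] G →
    ∀ (L′ : List Game) →
    (∀ Z → Z ∈ L′ ⇔ ((Z ∈ leftOpts G × ¬ (Z ≡ A)) ⊎ Z ∈ leftOpts AR)) →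
    G =[ x ] game L′ (score G) (rightOpts G))
    ×
    (∀ D → D ∈ rightOpts G → ∀ DL → DL ∈ leftOpts D → DL ≥[ x ] G →
    ∀ (R′ : List Game) →
    (∀ Z → Z ∈ R′ ⇔ ((Z ∈ rightOpts G × ¬ (Z ≡ D)) ⊎ Z ∈ rightOpts DL)) →
    G =[ x ] game (leftOpts G) (score G) R′)
mainTheorem5 ℝ x 0<x _ tG@(Scoring.tame {GL} {GR} _ _) =
  (λ A A∈ AR AR∈ AR≤G L′ L′-spec X tX →
    let pAR = levelled-leftRightOption pG A∈ AR∈
        pG′ = levelled (All-replacing L′-spec (leftOpts-levelled pG) (leftOpts-levelled pAR))
                       (rightOpts-levelled pG)
    in ≈-fromSameWinners (levelled-+ℓ-tame pG tX) (levelled-+ℓ-tame pG′ tX)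
         (LeftReversal.sameWinners {s′ = 0#} AR∈ L′-spec (≤ₓ⇒≤ʷ pAR pG AR≤G) tX))
  ,
  (λ D D∈ DL DL∈ DL≥G R′ R′-spec X tX →
    let pDL = levelled-rightLeftOption pG D∈ DL∈
        pG′ = levelled (leftOpts-levelled pG)
                       (All-replacing R′-spec (rightOpts-levelled pG) (rightOpts-levelled pDL))
    in ≈-fromSameWinners (levelled-+ℓ-tame pG tX) (levelled-+ℓ-tame pG′ tX)
         (RightReversal.sameWinners {s′ = 0#} DL∈ R′-spec (≥ₓ⇒≤ʷ pDL pG DL≥G) tX))
  where
  open ScoringPlay ℝ
  open TameGames x
  open Levels x 0<x

  pG : Levelled 0# (game GL 0# GR)
  pG = tame⇒levelled tG
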